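{- There is no rule $\mathsf{R}$ of the form "from $A_1,\ldots,A_n$ infer $B$" (with $A_1,\dots,A_n,B\in\mathsf{Form}_{\bot,\supset}$), where $B$ is disjunction-free, such that (i) $\mathsf{R}$ is admissible in $\mathbf{S}_\bot2$ and (ii) the system $\mathbf{S}^-_\bot2+\mathsf{R}$ derives $(p\supset r)\to((q\supset r)\to((p\lor q)\supset r))$.
   Context: $\mathsf{Form}_{\bot,\supset}$: formulas built from a countable set $\mathsf{Prop}$ of propositional variables (including distinct $p,q,r$) and the constant $\bot$ using binary connectives $\land,\lor,\to,\supset$; disjunction-free means $\lor$ does not occur. A rule "from $A_1,\ldots,A_n$ infer $B$" is admissible in a system if whenever each $A_i$ is provable in the system, so is $B$. $\mathbf{S}_\bot2$ has the following single axioms (with fixed distinct propositional variables $p,q,r$): (Ax0) $\bot\to p$; (Ax1) $p\to(q\to p)$; (Ax2) $(p\to(q\to r))\to((p\to q)\to(p\to r))$; (Ax3) $(p\land q)\to p$; (Ax4) $(p\land q)\to q$; (Ax5) $(r\to p)\to((r\to q)\to(r\to(p\land q)))$; (Ax6) $p\to(p\lor q)$; (Ax7) $q\to(p\lor q)$; (Ax8) $(p\to r)\to((q\to r)\to((p\lor q)\to r))$; (AxM1) $(p\to q)\supset(p\supset q)$; (AxM2) $(p\supset(q\supset r))\to((p\supset q)\supset(p\supset r))$; (AxM3) $(p\supset(q\to r))\to(q\to(p\supset r))$; (AxM4) $(p\to(q\supset r))\to(q\supset(p\to r))$; (AxM5) $((p\supset q)\supset r)\to((p\supset r)\to r)$;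 (AxM6') $(p\supset r)\to((q\supset r)\to((p\lor q)\supset r))$; and rules: (MP) from $A$ and $A\supset B$ infer $B$; (Sub) from $A$ infer $A[p/B]$ (uniform substitution of $B$ for all occurrences of a propositional variable $p$). $\mathbf{S}^-_\bot2$ is the same system without the axiom (AxM6'); $\mathbf{S}^-_\bot2+\mathsf{R}$ is $\mathbf{S}^-_\bot2$ with $\mathsf{R}$ added as a rule. $\vdash A$ means $A$ is derivable from no assumptions. -}

module Defs where

open import Data.Nat using (ℕ; _≟_)
open import Data.List using (List)
open import Data.List.Relation.Unary.All using (All)
open import Data.List.Membership.Propositional using (_∈_)
open import Data.Product using (_×_; _,_; proj₁; proj₂)
open import Data.Sum using (_⊎_)
open import Relation.Nullary using (yes; no)

Var : Set
Var = ℕ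

infixr 6 _∧_
infixr 5 _∨_
infixr 4 _⇒_ _⊃_
data Form : Set where
  var : Var → Form
  ⊥'  : Form
  _∧_ : Form → Form → Form
  _∨_ : Form → Form → Form
  _⇒_ : Form → Form → Form   -- the connective →
  _⊃_ : Form → Form → Form

p q r : Form
p = var 0
q = var 1
r = var 2

data DisjFree : Form → Set where
  df-var : ∀ n → DisjFree (var n)
  df-⊥   : DisjFree ⊥'
  df-∧   : ∀ {A B} → DisjFree A → DisjFree B → DisjFree (A ∧ B)
  df-⇒   : ∀ {A B} → DisjFree A → DisjFree B → DisjFree (A ⇒ B)
  df-⊃   : ∀ {A B} → DisjFree A → DisjFree B → DisjFree (A ⊃ B)

_[_/_] : Form → Var → Form → Form
var m   [ x / B ] with m ≟ x
... | yes _ = B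
... | no  _ = var m
⊥'      [ x / B ] = ⊥'
(C ∧ D) [ x / B ] = C [ x / B ] ∧ D [ x / B ]
(C ∨ D) [ x / B ] = C [ x / B ] ∨ D [ x / B ]
(C ⇒ D) [ x / B ] = C [ x / B ] ⇒ D [ x / B ]
(C ⊃ D) [ x / B ] = C [ x / B ] ⊃ D [ x / B ]

AxM6' : Form
AxM6' = (p ⊃ r) ⇒ ((q ⊃ r) ⇒ ((p ∨ q) ⊃ r))

data AxS⁻ : Form → Set where
  ax0  : AxS⁻ (⊥' ⇒ p)
  ax1  : AxS⁻ (p ⇒ (q ⇒ p))
  ax2  : AxS⁻ ((p ⇒ (q ⇒ r)) ⇒ ((p ⇒ q) ⇒ (p ⇒ r)))
  ax3  : AxS⁻ ((p ∧ q) ⇒ p)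
  ax4  : AxS⁻ ((p ∧ q) ⇒ q)
  ax5  : AxS⁻ ((r ⇒ p) ⇒ ((r ⇒ q) ⇒ (r ⇒ (p ∧ q))))
  ax6  : AxS⁻ (p ⇒ (p ∨ q))
  ax7  : AxS⁻ (q ⇒ (p ∨ q))
  ax8  : AxS⁻ ((p ⇒ r) ⇒ ((q ⇒ r) ⇒ ((p ∨ q) ⇒ r)))
  axM1 : AxS⁻ ((p ⇒ q) ⊃ (p ⊃ q))
  axM2 : AxS⁻ ((p ⊃ (q ⊃ r)) ⇒ ((p ⊃ q) ⊃ (p ⊃ r)))
  axM3 : AxS⁻ ((p ⊃ (q ⇒ r)) ⇒ (q ⇒ (p ⊃ r)))
  axM4 : AxS⁻ ((p ⇒ (q ⊃ r)) ⇒ (q ⊃ (p ⇒ r)))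
  axM5 : AxS⁻ (((p ⊃ q) ⊃ r) ⇒ ((p ⊃ r) ⇒ r))

data AxS : Form → Set where
  old   : ∀ {A} → AxS⁻ A → AxS A
  axM6' : AxS AxM6'

-- A rule "from A₁,…,Aₙ infer B": (premises , conclusion)
Rule : Set
Rule = List Form × Form

-- Derivability (from no assumptions) in the Hilbert system with axiom set
-- Ax, rules MP and Sub, plus the extra rules in Rs (applied literally).
data Prov (Ax : Form → Set) (Rs : List Rule) : Form → Set where
  axiom : ∀ {A} → Ax A → Prov Ax Rs A
  mp    : ∀ {A B} → Prov Ax Rs A → Prov Ax Rs (A ⊃ B) → Prov Ax Rs B
  sub   : ∀ {A} x B → Prov Ax Rs A → Prov Ax Rs (A [ x / B ])
  rule  : ∀ {R} → R ∈ Rs → All (Prov Ax Rs) (proj₁ R) → Prov Ax Rs (proj₂ R)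

⊢S : Form → Set
⊢S = Prov AxS (Data.List.[])

⊢S⁻+ : Rule → Form → Set
⊢S⁻+ R = Prov AxS⁻ (R Data.List.∷ Data.List.[])

AdmissibleS : Rule → Set
AdmissibleS R = All ⊢S (proj₁ R) → ⊢S (proj₂ R)

-- Both systems are interpreted in matrices whose only designated value is the top and in
-- which a ⊃ b is b when a is designated and the top otherwise, so MP is sound. The
-- four-element Boolean algebra B₄ validates S⁻_⊥2 but refutes (AxM6') at p, q, r =
-- (1,0), (0,1), (0,0), because there p ∨ q is the top. Adjoining a new top to B₄ gives a
-- Heyting algebra B₄⁺ in which the join of two undesignated values stays undesignated, so
-- B₄⁺ validates all of S_⊥2. Sending the top of B₄ to the new top embeds the ∨-free reduct
-- of B₄ into B₄⁺ and reflects designation, so every ∨-free theorem of S_⊥2 is valid in B₄.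
-- Consequently the instances of R used in an S⁻_⊥2 + R derivation, whose conclusions are
-- ∨-free theorems of S_⊥2 by admissibility, keep all theorems valid in B₄; (AxM6') is not.
module Submission where

open import Defs
open import Algebra.Core using (Op₂)
open import Data.Bool using (Bool; true; false; not) renaming (_∧_ to _∧ᵇ_; _∨_ to _∨ᵇ_)
import Data.Bool.Properties as Bool
open import Data.List using (List; []; _∷_; map)
open import Data.List.Membership.Propositional using (_∈_)
open import Data.List.Membership.Propositional.Properties using (∈-map⁺)
open import Data.List.Relation.Unary.All as All using (All; []; _∷_; all?)
open import Data.List.Relation.Unary.Any using (here; there)
open import Data.List.Relation.Unary.Enumerates.Setoid using (IsEnumeration)
open import Data.Nat using (suc; _≟_)
open import Data.Product using (Σ; _×_; _,_; proj₁; proj₂)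
open import Data.Product.Properties using (≡-dec)
open import Function using (_∘_)
open import Level using (Level; 0ℓ)
open import Relation.Binary.Definitions using (DecidableEquality)
open import Relation.Binary.PropositionalEquality
  using (_≡_; refl; cong; cong₂; sym; trans; subst; setoid)
open import Relation.Nullary using (¬_; Dec; yes; no)
open import Relation.Nullary.Decidable using (True; toWitness; map′; from-yes)
open import Relation.Unary using (Pred; Decidable)

private
  variable
    ℓ : Level
    A : Form
    Ax : Form → Set
    Rs : List Rule

module _ (P : Form → Set)
         (P-axiom : ∀ {A} → Ax A → P A)
         (P-mp : ∀ {A B} → P A → P (A ⊃ B) → P B)
         (P-sub : ∀ {A} x B → P A → P (A [ x / B ]))
         (P-rule : ∀ {R} → R ∈ Rs → All P (proj₁ R) → P (proj₂ R)) where

  Prov-ind : Prov Ax Rs A → P A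
  All-Prov-ind : ∀ {As} → All (Prov Ax Rs) As → All P As

  Prov-ind (axiom a) = P-axiom a
  Prov-ind (mp d e) = P-mp (Prov-ind d) (Prov-ind e)
  Prov-ind (sub x B d) = P-sub x B (Prov-ind d)
  Prov-ind (rule R∈Rs ds) = P-rule R∈Rs (All-Prov-ind ds)

  All-Prov-ind [] = []
  All-Prov-ind (d ∷ ds) = Prov-ind d ∷ All-Prov-ind ds

module _ {C : Set} {elements : List C} (enum : IsEnumeration (setoid C) elements) where

  ∀? : {P : Pred C ℓ} → Decidable P → Dec (∀ x → P x)
  ∀? P? = map′ (λ all x → All.lookup all (enum x)) (λ ∀P → All.tabulate (λ {x} _ → ∀P x))
               (all? P? elements)

record Matrix : Set₁ where
  infixr 6 _∧ᵐ_
  infixr 5 _∨ᵐ_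
  infixr 4 _⇒ᵐ_ _⊃ᵐ_
  field
    Carrier : Set
    ⊥ᵐ : Carrier
    _∧ᵐ_ _∨ᵐ_ _⇒ᵐ_ _⊃ᵐ_ : Op₂ Carrier
    Designated : Pred Carrier 0ℓ
    designated-mp : ∀ {a b} → Designated a → Designated (a ⊃ᵐ b) → Designated b

module Semantics (M : Matrix) where
  open Matrix M

  ⟦_⟧ : Form → (Var → Carrier) → Carrier
  ⟦ var x ⟧ ρ = ρ x
  ⟦ ⊥' ⟧ ρ = ⊥ᵐ
  ⟦ A ∧ B ⟧ ρ = ⟦ A ⟧ ρ ∧ᵐ ⟦ B ⟧ ρ
  ⟦ A ∨ B ⟧ ρ = ⟦ A ⟧ ρ ∨ᵐ ⟦ B ⟧ ρ
  ⟦ A ⇒ B ⟧ ρ = ⟦ A ⟧ ρ ⇒ᵐ ⟦ B ⟧ ρ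
  ⟦ A ⊃ B ⟧ ρ = ⟦ A ⟧ ρ ⊃ᵐ ⟦ B ⟧ ρ

  Valid : Form → Set
  Valid A = ∀ ρ → Designated (⟦ A ⟧ ρ)

  _[_↦_] : (Var → Carrier) → Var → Carrier → Var → Carrier
  (ρ [ x ↦ a ]) y with y ≟ x
  ... | yes _ = a
  ... | no  _ = ρ y

  ⟦⟧-[/] : ∀ A x B ρ → ⟦ A [ x / B ] ⟧ ρ ≡ ⟦ A ⟧ (ρ [ x ↦ ⟦ B ⟧ ρ ])
  ⟦⟧-[/] (var y) x B ρ with y ≟ x
  ... | yes _ = refl
  ... | no  _ = refl
  ⟦⟧-[/] ⊥' x B ρ = refl
  ⟦⟧-[/] (A₁ ∧ A₂) x B ρ = cong₂ _∧ᵐ_ (⟦⟧-[/] A₁ x B ρ) (⟦⟧-[/] A₂ x B ρ)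
  ⟦⟧-[/] (A₁ ∨ A₂) x B ρ = cong₂ _∨ᵐ_ (⟦⟧-[/] A₁ x B ρ) (⟦⟧-[/] A₂ x B ρ)
  ⟦⟧-[/] (A₁ ⇒ A₂) x B ρ = cong₂ _⇒ᵐ_ (⟦⟧-[/] A₁ x B ρ) (⟦⟧-[/] A₂ x B ρ)
  ⟦⟧-[/] (A₁ ⊃ A₂) x B ρ = cong₂ _⊃ᵐ_ (⟦⟧-[/] A₁ x B ρ) (⟦⟧-[/] A₂ x B ρ)

  valid-mp : ∀ {A B} → Valid A → Valid (A ⊃ B) → Valid B
  valid-mp ⊨A ⊨A⊃B ρ = designated-mp (⊨A ρ) (⊨A⊃B ρ)

  valid-sub : ∀ {A} x B → Valid A → Valid (A [ x / B ])
  valid-sub {A} x B ⊨A ρ = subst Designated (sym (⟦⟧-[/] A x B ρ)) (⊨A _)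

  sound : (∀ {A} → Ax A → Valid A) → Prov Ax [] A → Valid A
  sound ⊨Ax = Prov-ind {Rs = []} Valid ⊨Ax
    (λ {A} {B} → valid-mp {A} {B}) (λ {A} → valid-sub {A}) (λ ())

  -- On formulas in p, q, r alone, ⟦ A ⟧ (pqr (ρ 0) (ρ 1) (ρ 2)) computes to ⟦ A ⟧ ρ, so for
  -- a concrete such A the decision below yields Valid A by conversion.
  pqr : Carrier → Carrier → Carrier → Var → Carrier
  pqr a b c 0 = a
  pqr a b c 1 = b
  pqr a b c 2 = c
  pqr a b c (suc (suc (suc _))) = a

  module Enumerated {elements : List Carrier} (enum : IsEnumeration (setoid Carrier) elements)
                    (designated? : Decidable Designated) where

    valid-pqr? : ∀ A → Dec (∀ a b c → Designated (⟦ A ⟧ (pqr a b c)))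
    valid-pqr? A = ∀? enum λ a → ∀? enum λ b → ∀? enum λ c → designated? (⟦ A ⟧ (pqr a b c))

    by-enumeration : ∀ A → {True (valid-pqr? A)} →
                     ∀ (ρ : Var → Carrier) → Designated (⟦ A ⟧ (pqr (ρ 0) (ρ 1) (ρ 2)))
    by-enumeration A {yes!} ρ = toWitness yes! (ρ 0) (ρ 1) (ρ 2)

record DisjFreeHom (M N : Matrix) : Set where
  private
    module M = Matrix M
    module N = Matrix N
  field
    h : M.Carrier → N.Carrier
    h-⊥ : h M.⊥ᵐ ≡ N.⊥ᵐ
    h-∧ : ∀ a b → h (a M.∧ᵐ b) ≡ (h a N.∧ᵐ h b)
    h-⇒ : ∀ a b → h (a M.⇒ᵐ b) ≡ (h a N.⇒ᵐ h b)
    h-⊃ : ∀ a b → h (a M.⊃ᵐ b) ≡ (h a N.⊃ᵐ h b)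
    h-reflects-designated : ∀ {a} → N.Designated (h a) → M.Designated a

module _ {M N : Matrix} (φ : DisjFreeHom M N) where
  open DisjFreeHom φ
  private
    module N = Matrix N
    module ⟦M⟧ = Semantics M
    module ⟦N⟧ = Semantics N

  ⟦⟧-hom : DisjFree A → ∀ ρ → ⟦N⟧.⟦ A ⟧ (h ∘ ρ) ≡ h (⟦M⟧.⟦ A ⟧ ρ)
  ⟦⟧-hom (df-var x) ρ = refl
  ⟦⟧-hom df-⊥ ρ = sym h-⊥
  ⟦⟧-hom (df-∧ dA dB) ρ = trans (cong₂ N._∧ᵐ_ (⟦⟧-hom dA ρ) (⟦⟧-hom dB ρ)) (sym (h-∧ _ _))
  ⟦⟧-hom (df-⇒ dA dB) ρ = trans (cong₂ N._⇒ᵐ_ (⟦⟧-hom dA ρ) (⟦⟧-hom dB ρ)) (sym (h-⇒ _ _))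
  ⟦⟧-hom (df-⊃ dA dB) ρ = trans (cong₂ N._⊃ᵐ_ (⟦⟧-hom dA ρ) (⟦⟧-hom dB ρ)) (sym (h-⊃ _ _))

  valid-reflect : DisjFree A → ⟦N⟧.Valid A → ⟦M⟧.Valid A
  valid-reflect dA ⊨A ρ =
    h-reflects-designated (subst N.Designated (⟦⟧-hom dA ρ) (⊨A (h ∘ ρ)))

B₄ : Set
B₄ = Bool × Bool

pattern ⊤₄ = (true , true)
pattern ⊥₄ = (false , false)

infixr 6 _⊓_
infixr 5 _⊔_
infixr 4 _⇛_ _⊃₄_

_⊓_ _⊔_ _⇛_ _⊃₄_ : Op₂ B₄
(a , b) ⊓ (c , d) = a ∧ᵇ c , b ∧ᵇ d
(a , b) ⊔ (c , d) = a ∨ᵇ c , b ∨ᵇ d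
(a , b) ⇛ (c , d) = not a ∨ᵇ c , not b ∨ᵇ d
⊤₄ ⊃₄ y = y
(true , false) ⊃₄ y = ⊤₄
(false , _) ⊃₄ y = ⊤₄

_≟₄_ : DecidableEquality B₄
_≟₄_ = ≡-dec Bool._≟_ Bool._≟_

B₄-elements : List B₄
B₄-elements = ⊥₄ ∷ (true , false) ∷ (false , true) ∷ ⊤₄ ∷ []

B₄-enumeration : IsEnumeration (setoid B₄) B₄-elements
B₄-enumeration ⊥₄ = here refl
B₄-enumeration (true , false) = there (here refl)
B₄-enumeration (false , true) = there (there (here refl))
B₄-enumeration ⊤₄ = there (there (there (here refl)))

BA₄ : Matrix
BA₄ = record
  { Carrier = B₄ ; ⊥ᵐ = ⊥₄ ; _∧ᵐ_ = _⊓_ ; _∨ᵐ_ = _⊔_ ; _⇒ᵐ_ = _⇛_ ; _⊃ᵐ_ = _⊃₄_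
  ; Designated = _≡ ⊤₄ ; designated-mp = λ { refl ⊨b → ⊨b } }

data B₄⁺ : Set where
  ⌊_⌋ : B₄ → B₄⁺
  ⊤⁺ : B₄⁺

lift : B₄ → B₄⁺
lift ⊤₄ = ⊤⁺
lift (true , false) = ⌊ true , false ⌋
lift (false , b) = ⌊ false , b ⌋

infixr 6 _∧⁺_
infixr 5 _∨⁺_
infixr 4 _⇒⁺_ _⊃⁺_

_∧⁺_ _∨⁺_ _⇒⁺_ _⊃⁺_ : Op₂ B₄⁺
⌊ a ⌋ ∧⁺ ⌊ b ⌋ = ⌊ a ⊓ b ⌋
⊤⁺ ∧⁺ y = y
x ∧⁺ ⊤⁺ = x
⌊ a ⌋ ∨⁺ ⌊ b ⌋ = ⌊ a ⊔ b ⌋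
⊤⁺ ∨⁺ y = ⊤⁺
x ∨⁺ ⊤⁺ = ⊤⁺
-- Heyting implication after adjoining a top: a ⇛ b is the old top exactly when a ≤ b.
⌊ a ⌋ ⇒⁺ ⌊ b ⌋ = lift (a ⇛ b)
⊤⁺ ⇒⁺ y = y
x ⇒⁺ ⊤⁺ = ⊤⁺
⊤⁺ ⊃⁺ y = y
⌊ _ ⌋ ⊃⁺ y = ⊤⁺

_≟⁺_ : DecidableEquality B₄⁺
⌊ a ⌋ ≟⁺ ⌊ b ⌋ = map′ (cong ⌊_⌋) (λ { refl → refl }) (a ≟₄ b)
⌊ _ ⌋ ≟⁺ ⊤⁺ = no λ ()
⊤⁺ ≟⁺ ⌊ _ ⌋ = no λ ()
⊤⁺ ≟⁺ ⊤⁺ = yes refl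

B₄⁺-enumeration : IsEnumeration (setoid B₄⁺) (⊤⁺ ∷ map ⌊_⌋ B₄-elements)
B₄⁺-enumeration ⊤⁺ = here refl
B₄⁺-enumeration ⌊ a ⌋ = there (∈-map⁺ ⌊_⌋ (B₄-enumeration a))

BA₄⁺ : Matrix
BA₄⁺ = record
  { Carrier = B₄⁺ ; ⊥ᵐ = ⌊ ⊥₄ ⌋ ; _∧ᵐ_ = _∧⁺_ ; _∨ᵐ_ = _∨⁺_ ; _⇒ᵐ_ = _⇒⁺_ ; _⊃ᵐ_ = _⊃⁺_
  ; Designated = _≡ ⊤⁺ ; designated-mp = λ { refl ⊨b → ⊨b } }

lift-hom : DisjFreeHom BA₄ BA₄⁺
lift-hom = record
  { h = lift
  ; h-⊥ = refl
  ; h-∧ = from-yes (∀₂? λ a b → lift (a ⊓ b) ≟⁺ (lift a ∧⁺ lift b))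
  ; h-⇒ = from-yes (∀₂? λ a b → lift (a ⇛ b) ≟⁺ (lift a ⇒⁺ lift b))
  ; h-⊃ = from-yes (∀₂? λ a b → lift (a ⊃₄ b) ≟⁺ (lift a ⊃⁺ lift b))
  ; h-reflects-designated = λ { {⊤₄} _ → refl } }
  where
    ∀₂? : {P : B₄ → B₄ → Set} → (∀ a b → Dec (P a b)) → Dec (∀ a b → P a b)
    ∀₂? P? = ∀? B₄-enumeration λ a → ∀? B₄-enumeration (P? a)

module ⟦B₄⟧ = Semantics BA₄
module ⟦B₄⁺⟧ = Semantics BA₄⁺
open Semantics.Enumerated BA₄ B₄-enumeration (_≟₄ ⊤₄)
  renaming (by-enumeration to B₄-by-enumeration)
open Semantics.Enumerated BA₄⁺ B₄⁺-enumeration (_≟⁺ ⊤⁺)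
  renaming (by-enumeration to B₄⁺-by-enumeration)

B₄-valid-S⁻ : AxS⁻ A → ⟦B₄⟧.Valid A
B₄-valid-S⁻ {A} ax0 = B₄-by-enumeration A
B₄-valid-S⁻ {A} ax1 = B₄-by-enumeration A
B₄-valid-S⁻ {A} ax2 = B₄-by-enumeration A
B₄-valid-S⁻ {A} ax3 = B₄-by-enumeration A
B₄-valid-S⁻ {A} ax4 = B₄-by-enumeration A
B₄-valid-S⁻ {A} ax5 = B₄-by-enumeration A
B₄-valid-S⁻ {A} ax6 = B₄-by-enumeration A
B₄-valid-S⁻ {A} ax7 = B₄-by-enumeration A
B₄-valid-S⁻ {A} ax8 = B₄-by-enumeration A
B₄-valid-S⁻ {A} axM1 = B₄-by-enumeration A
B₄-valid-S⁻ {A} axM2 = B₄-by-enumeration A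
B₄-valid-S⁻ {A} axM3 = B₄-by-enumeration A
B₄-valid-S⁻ {A} axM4 = B₄-by-enumeration A
B₄-valid-S⁻ {A} axM5 = B₄-by-enumeration A

B₄⁺-valid-S : AxS A → ⟦B₄⁺⟧.Valid A
B₄⁺-valid-S {A} (old ax0) = B₄⁺-by-enumeration A
B₄⁺-valid-S {A} (old ax1) = B₄⁺-by-enumeration A
B₄⁺-valid-S {A} (old ax2) = B₄⁺-by-enumeration A
B₄⁺-valid-S {A} (old ax3) = B₄⁺-by-enumeration A
B₄⁺-valid-S {A} (old ax4) = B₄⁺-by-enumeration A
B₄⁺-valid-S {A} (old ax5) = B₄⁺-by-enumeration A
B₄⁺-valid-S {A} (old ax6) = B₄⁺-by-enumeration A
B₄⁺-valid-S {A} (old ax7) = B₄⁺-by-enumeration A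
B₄⁺-valid-S {A} (old ax8) = B₄⁺-by-enumeration A
B₄⁺-valid-S {A} (old axM1) = B₄⁺-by-enumeration A
B₄⁺-valid-S {A} (old axM2) = B₄⁺-by-enumeration A
B₄⁺-valid-S {A} (old axM3) = B₄⁺-by-enumeration A
B₄⁺-valid-S {A} (old axM4) = B₄⁺-by-enumeration A
B₄⁺-valid-S {A} (old axM5) = B₄⁺-by-enumeration A
B₄⁺-valid-S {A} axM6' = B₄⁺-by-enumeration A

AxM6'-invalid-in-B₄ : ¬ ⟦B₄⟧.Valid AxM6'
AxM6'-invalid-in-B₄ ⊨AxM6' with ⊨AxM6' (⟦B₄⟧.pqr (true , false) (false , true) ⊥₄)
... | ()

B₄-valid-⊢S-disjFree : DisjFree A → ⊢S A → ⟦B₄⟧.Valid A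
B₄-valid-⊢S-disjFree dA ⊢A = valid-reflect lift-hom dA (⟦B₄⁺⟧.sound B₄⁺-valid-S ⊢A)

module _ {R : Rule} (dB : DisjFree (proj₂ R)) (R-admissible : AdmissibleS R) where

  ⊢S⁻+⇒⊢S×B₄-valid : ⊢S⁻+ R A → ⊢S A × ⟦B₄⟧.Valid A
  ⊢S⁻+⇒⊢S×B₄-valid = Prov-ind (λ A → ⊢S A × ⟦B₄⟧.Valid A)
    (λ a → axiom (old a) , B₄-valid-S⁻ a)
    (λ {A} {B} (⊢A , ⊨A) (⊢A⊃B , ⊨A⊃B) → mp ⊢A ⊢A⊃B , ⟦B₄⟧.valid-mp {A} {B} ⊨A ⊨A⊃B)
    (λ {A} x B (⊢A , ⊨A) → sub x B ⊢A , ⟦B₄⟧.valid-sub {A} x B ⊨A)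
    λ { (here refl) premises → let ⊢B = R-admissible (All.map proj₁ premises)
                               in ⊢B , B₄-valid-⊢S-disjFree dB ⊢B }

mainTheorem17 : ¬ (Σ Rule (λ R → DisjFree (proj₂ R) × AdmissibleS R × ⊢S⁻+ R AxM6'))
mainTheorem17 (R , dB , R-admissible , ⊢AxM6') =
  AxM6'-invalid-in-B₄ (proj₂ (⊢S⁻+⇒⊢S×B₄-valid dB R-admissible ⊢AxM6'))
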